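{- For every $\phi\in\mathcal{L}_u$ there is a nonempty set $\mathcal{C}$ of teams over $\mathbb{P}$ such that $\phi\vdash\Psi^*_{\mathcal{C}}$ and $\Psi^*_{\mathcal{C}}\vdash\phi$ in the natural deduction system for $\mathcal{L}_u$.
   Context: Fix a finite set $\mathbb{P}$ of propositional symbols, enumerated without repetition as $\mathsf{p}=p_1\dots p_n$; a valuation is $v:\mathbb{P}\to\{0,1\}$; a team is a set of valuations. $\mathcal{L}_u$: $\phi::=\top\mid\mathsf{x}\subseteqq\mathsf{q}\mid\phi\land\phi\mid\phi\sqcup\phi$, with $\mathsf{x}$ a finite sequence of constants $\top,\bot$, $\mathsf{q}$ a sequence of symbols of $\mathbb{P}$ without repetitions, $|\mathsf{x}|=|\mathsf{q}|$. For a valuation $v$, $\mathsf{x}^v=c_1\dots c_n$ with $c_i=\top$ if $v(p_i)=1$, else $\bot$. For a team $T$, $\psi^*_T:=\bigwedge_{v\in T}\mathsf{x}^v\subseteqq\mathsf{p}$ (with $\psi^*_\emptyset=\top$), and for nonempty $\mathcal{C}$, $\Psi^*_{\mathcal{C}}:=\bigsqcup_{T\in\mathcal{C}}\psi^*_T$ (in some fixed order and bracketing). $\vdash$ uses the rules: ($\top$I) infer $\top$; ($\land$I) from $\phi,\psi$ infer $\phi\land\psi$; ($\land$E) from $\phi\land\psi$ infer $\phi$, and $\psi$; ($\sqcup$I) from $\phi$ infer $\phi\sqcup\psi$ and $\psi\sqcup\phi$; ($\sqcup$E) from $\phi\sqcup\psi$ and derivations of $\chi$ from $\phi$ and from $\psi$,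 infer $\chi$ discharging them; ($\subseteqq$Proj) from $\mathsf{x}y\subseteqq\mathsf{p}q$ infer $\mathsf{x}\subseteqq\mathsf{p}$; ($\subseteqq$Perm) from $\mathsf{x}\mathsf{y}\mathsf{z}\subseteqq\mathsf{u}\mathsf{v}\mathsf{w}$ infer $\mathsf{x}\mathsf{z}\mathsf{y}\subseteqq\mathsf{u}\mathsf{w}\mathsf{v}$ provided $|\mathsf{y}|=|\mathsf{v}|$, $|\mathsf{z}|=|\mathsf{w}|$; ($\subseteqq$Ext) from $\mathsf{x}\subseteqq\mathsf{p}$ and derivations of $\chi$ from $\mathsf{x}\top\subseteqq\mathsf{p}q$ and from $\mathsf{x}\bot\subseteqq\mathsf{p}q$ ($q$ a symbol not in $\mathsf{p}$), infer $\chi$ discharging them. -}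

module Defs where

open import Data.Nat using (ℕ)
open import Data.Bool using (Bool; true; false)
open import Data.Fin using (Fin)
open import Data.List using (List; []; _∷_; [_]; _++_; length; map; allFin)
open import Data.Vec using (Vec; toList)
open import Data.List.Membership.Propositional using (_∈_; _∉_)
open import Data.List.Relation.Unary.Unique.Propositional using (Unique)
open import Data.List.Relation.Unary.AllPairs using (AllPairs)
open import Data.List.Relation.Binary.Permutation.Propositional using (_↭_)
open import Data.Product using (_×_)
open import Data.Unit using (⊤)
open import Data.Empty using (⊥)
open import Data.List.Relation.Unary.All using (All)
open import Relation.Binary.PropositionalEquality using (_≡_)
open import Relation.Nullary using (¬_)

-- The set ℙ of propositional symbols is Fin n, enumerated p = p₁ … pₙ
-- as allFin n (i.e. in the order 0,1,…,n-1).
-- Constants: true stands for ⊤, false stands for ⊥.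
Const : Set
Const = Bool

infixr 6 _∧'_
infixr 5 _⊔'_
data Form (n : ℕ) : Set where
  ⊤'    : Form n
  _⊆'_  : List Const → List (Fin n) → Form n
  _∧'_  : Form n → Form n → Form n
  _⊔'_  : Form n → Form n → Form n

WF : ∀ {n} → Form n → Set
WF ⊤'        = ⊤
WF (x ⊆' q)  = Unique q × (length x ≡ length q)
WF (φ ∧' ψ)  = WF φ × WF ψ
WF (φ ⊔' ψ)  = WF φ × WF ψ

infix 3 _⊢_
data _⊢_ {n : ℕ} (Γ : List (Form n)) : Form n → Set where
  hyp   : ∀ {φ} → φ ∈ Γ → Γ ⊢ φ
  ⊤I    : Γ ⊢ ⊤'
  ∧I    : ∀ {φ ψ} → Γ ⊢ φ → Γ ⊢ ψ → Γ ⊢ φ ∧' ψ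
  ∧E₁   : ∀ {φ ψ} → Γ ⊢ φ ∧' ψ → Γ ⊢ φ
  ∧E₂   : ∀ {φ ψ} → Γ ⊢ φ ∧' ψ → Γ ⊢ ψ
  ⊔I₁   : ∀ {φ ψ} → Γ ⊢ φ → Γ ⊢ φ ⊔' ψ
  ⊔I₂   : ∀ {φ ψ} → Γ ⊢ ψ → Γ ⊢ φ ⊔' ψ
  ⊔E    : ∀ {φ ψ χ} → Γ ⊢ φ ⊔' ψ → (φ ∷ Γ) ⊢ χ → (ψ ∷ Γ) ⊢ χ → Γ ⊢ χ
  ⊆Proj : ∀ {x y p q} → Γ ⊢ (x ++ [ y ]) ⊆' (p ++ [ q ]) → Γ ⊢ x ⊆' p
  ⊆Perm : ∀ {x y z u v w} → length y ≡ length v → length z ≡ length w →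
          Γ ⊢ (x ++ y ++ z) ⊆' (u ++ v ++ w) →
          Γ ⊢ (x ++ z ++ y) ⊆' (u ++ w ++ v)
  ⊆Ext  : ∀ {x p q χ} → q ∉ p → Γ ⊢ x ⊆' p →
          ((x ++ [ true ]) ⊆' (p ++ [ q ]) ∷ Γ) ⊢ χ →
          ((x ++ [ false ]) ⊆' (p ++ [ q ]) ∷ Γ) ⊢ χ →
          Γ ⊢ χ

Valuation : ℕ → Set
Valuation n = Vec Bool n

Team : ℕ → Set
Team n = List (Valuation n)

IsTeam : ∀ {n} → Team n → Set
IsTeam T = Unique T

xv : ∀ {n} → Valuation n → List Const
xv v = toList v

⋀ : ∀ {n} → List (Form n) → Form n
⋀ []           = ⊤'
⋀ (φ ∷ [])     = φ
⋀ (φ ∷ ψ ∷ φs) = φ ∧' ⋀ (ψ ∷ φs)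

⨆ : ∀ {n} → List (Form n) → Form n
⨆ []           = ⊤'   -- unused: 𝒞 is required to be nonempty
⨆ (φ ∷ [])     = φ
⨆ (φ ∷ ψ ∷ φs) = φ ⊔' ⨆ (ψ ∷ φs)

ψ* : ∀ {n} → Team n → Form n
ψ* {n} T = ⋀ (map (λ v → xv v ⊆' allFin n) T)

Ψ* : ∀ {n} → List (Team n) → Form n
Ψ* 𝒞 = ⨆ (map ψ* 𝒞)

-- A nonempty set 𝒞 of teams: nonempty list of teams, each a set of valuations,
-- no two of which are the same set (i.e. permutations of each other).
IsNonemptyTeamSet : ∀ {n} → List (Team n) → Set
IsNonemptyTeamSet []       = ⊥
IsNonemptyTeamSet (T ∷ 𝒞) =
  All IsTeam (T ∷ 𝒞) × AllPairs (λ S R → ¬ (S ↭ R)) (T ∷ 𝒞)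

-- By induction on the formula.  ⊤ is ψ*_∅; a disjunction concatenates the two families of
-- teams; a conjunction takes all pairwise unions T ∪ S, since ψ*_{T ∪ S} is ψ*_T ∧ ψ*_S.
-- An atom x ⊆ q is interderivable with the disjunction of the full atoms x^v ⊆ p over the
-- valuations v that agree with x on q: one direction permutes and projects x^v ⊆ p down to
-- x ⊆ q; the other splits with ⊆Ext on every symbol outside q, which leaves in each branch
-- a full atom that is then permuted into the order of p.  Finally, repeated valuations and
-- teams with the same elements are merged, so that the family becomes a set of teams.
module Submission where

open import Data.Bool as Bool using (Bool; true; false)
open import Data.Empty using (⊥-elim)
open import Data.Fin using (Fin; _≟_)
open import Data.List
  using (List; []; _∷_; [_]; _++_; map; length; filter; tabulate; zip; allFin;
         cartesianProductWith; deduplicate)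
open import Data.List.Properties using (map-++; length-map; ++-assoc; ++-identityʳ; map-tabulate)
open import Data.List.Membership.Propositional using (_∈_; _∉_)
open import Data.List.Membership.Propositional.Properties
  using (∈-∃++; ∈-map⁺; ∈-map⁻; ∈-++⁻; ∈-++⁺ˡ; ∈-++⁺ʳ; ∈-tabulate⁺; ∈-tabulate⁻; ∈-filter⁺;
         ∈-filter⁻; ∈-allFin; ∈-cartesianProductWith⁺; ∈-cartesianProductWith⁻;
         ∈-deduplicate⁺; ∈-deduplicate⁻)
open import Data.List.Relation.Binary.Permutation.Propositional using (↭-sym)
open import Data.List.Relation.Binary.Subset.Propositional using (_⊆_)
open import Data.List.Relation.Binary.Subset.Propositional.Properties
  using (⊆-reflexive-↭; ∷⁺ʳ; xs⊆x∷xs; xs⊆xs++ys; xs⊆ys++xs)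
open import Data.List.Relation.Unary.All as All using (All; []; _∷_)
import Data.List.Relation.Unary.All.Properties as All
open import Data.List.Relation.Unary.AllPairs as AllPairs using (AllPairs; []; _∷_)
import Data.List.Relation.Unary.AllPairs.Properties as AllPairs
open import Data.List.Relation.Unary.Any as Any using (Any; here; there)
import Data.List.Relation.Unary.Any.Properties as Any
open import Data.List.Relation.Unary.Unique.Propositional using (Unique)
import Data.List.Relation.Unary.Unique.Propositional.Properties as Unique
open import Data.Nat using (ℕ; zero; suc)
open import Data.Nat.Properties using (suc-injective)
open import Data.Product using (Σ; ∃; _×_; _,_; proj₁; proj₂)
open import Data.Product.Properties using () renaming (≡-dec to ×-≡-dec)
open import Data.Sum using ([_,_]′; inj₁; inj₂)
open import Data.Vec as Vec using ([]; _∷_; lookup; toList)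
open import Data.Vec.Properties using (lookup∘tabulate) renaming (≡-dec to Vec-≡-dec)
open import Function using (_∘_)
open import Level using (0ℓ)
open import Relation.Binary using (Rel; Decidable; DecidableEquality)
open import Relation.Binary.PropositionalEquality
  using (_≡_; refl; sym; trans; cong; cong₂; subst; setoid)
open import Relation.Nullary using (¬_; ¬?; yes; no; _×-dec_)

open import Defs

private
  variable
    A B : Set
    n : ℕ
    Γ Δ : List (Form n)
    φ φ′ ψ ψ′ χ : Form n
    φs : List (Form n)
    v : Valuation n
    S T U : Team n
    C D : List (Team n)
    K L M : List (Const × Fin n)
    a : Const × Fin n
    r : Fin n

-- Quantified over the context because ⊔E and ⊆Ext extend it: this way φ ⇛ ψ can be applied
-- inside their branches.
infix 3 _⇛_

_⇛_ : Form n → Form n → Set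
φ ⇛ ψ = ∀ {Γ} → Γ ⊢ φ → Γ ⊢ ψ

⊢-weaken : Γ ⊆ Δ → Γ ⊢ φ → Δ ⊢ φ
⊢-weaken ρ (hyp φ∈Γ)  = hyp (ρ φ∈Γ)
⊢-weaken ρ ⊤I         = ⊤I
⊢-weaken ρ (∧I d e)   = ∧I (⊢-weaken ρ d) (⊢-weaken ρ e)
⊢-weaken ρ (∧E₁ d)    = ∧E₁ (⊢-weaken ρ d)
⊢-weaken ρ (∧E₂ d)    = ∧E₂ (⊢-weaken ρ d)
⊢-weaken ρ (⊔I₁ d)    = ⊔I₁ (⊢-weaken ρ d)
⊢-weaken ρ (⊔I₂ d)    = ⊔I₂ (⊢-weaken ρ d)
⊢-weaken ρ (⊔E d e f) = ⊔E (⊢-weaken ρ d) (⊢-weaken (∷⁺ʳ _ ρ) e) (⊢-weaken (∷⁺ʳ _ ρ) f)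
⊢-weaken ρ (⊆Proj {x} {y} {p} {q} d) = ⊆Proj {x = x} {y} {p} {q} (⊢-weaken ρ d)
⊢-weaken ρ (⊆Perm {x} {y} {z} {u} {v} {w} ∣y∣ ∣z∣ d) =
  ⊆Perm {x = x} {y} {z} {u} {v} {w} ∣y∣ ∣z∣ (⊢-weaken ρ d)
⊢-weaken ρ (⊆Ext {x} {p} {q} q∉p d e f) =
  ⊆Ext {x = x} {p} {q} q∉p (⊢-weaken ρ d) (⊢-weaken (∷⁺ʳ _ ρ) e) (⊢-weaken (∷⁺ʳ _ ρ) f)

⊢-cut : Γ ⊢ φ → φ ∷ Γ ⊢ χ → Γ ⊢ χ
⊢-cut {φ = φ} d e = ⊔E (⊔I₁ {ψ = φ} d) e e

⊔-case : φ ⇛ χ → ψ ⇛ χ → φ ⊔' ψ ⇛ χ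
⊔-case f g d = ⊔E d (f (hyp (here refl))) (g (hyp (here refl)))

⊔-mono : φ ⇛ φ′ → ψ ⇛ ψ′ → φ ⊔' ψ ⇛ φ′ ⊔' ψ′
⊔-mono f g = ⊔-case (⊔I₁ ∘ f) (⊔I₂ ∘ g)

∧-mono : φ ⇛ φ′ → ψ ⇛ ψ′ → φ ∧' ψ ⇛ φ′ ∧' ψ′
∧-mono f g d = ∧I (f (∧E₁ d)) (g (∧E₂ d))

⋀-intro : All (Γ ⊢_) φs → Γ ⊢ ⋀ φs
⋀-intro []               = ⊤I
⋀-intro (d ∷ [])         = d
⋀-intro (d ∷ ds@(_ ∷ _)) = ∧I d (⋀-intro ds)

⋀-elim : Γ ⊢ ⋀ φs → All (Γ ⊢_) φs
⋀-elim {φs = []}        _ = []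
⋀-elim {φs = _ ∷ []}    d = d ∷ []
⋀-elim {φs = _ ∷ _ ∷ _} d = ∧E₁ d ∷ ⋀-elim (∧E₂ d)

⨆-intro : Any (Γ ⊢_) φs → Γ ⊢ ⨆ φs
⨆-intro {φs = _ ∷ []}    (here d)  = d
⨆-intro {φs = _ ∷ _ ∷ _} (here d)  = ⊔I₁ d
⨆-intro {φs = _ ∷ _ ∷ _} (there d) = ⊔I₂ (⨆-intro d)

⨆-elim : Γ ⊢ ⨆ (φ ∷ φs) → All (λ ψ → ψ ∷ Γ ⊢ χ) (φ ∷ φs) → Γ ⊢ χ
⨆-elim {φs = []}    d (e ∷ []) = ⊢-cut d e
⨆-elim {φs = _ ∷ _} d (e ∷ es) =
  ⊔E d e (⨆-elim (hyp (here refl)) (All.map (⊢-weaken (∷⁺ʳ _ (xs⊆x∷xs _ _))) es))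

atom : Valuation n → Form n
atom {n} v = xv v ⊆' allFin n

ψ*-intro : (∀ {v} → v ∈ T → Γ ⊢ atom v) → Γ ⊢ ψ* T
ψ*-intro h = ⋀-intro (All.map⁺ (All.tabulate h))

ψ*-elim : Γ ⊢ ψ* T → v ∈ T → Γ ⊢ atom v
ψ*-elim d = All.lookup (All.map⁻ (⋀-elim d))

ψ*-antitone : S ⊆ T → ψ* T ⇛ ψ* S
ψ*-antitone S⊆T d = ψ*-intro (ψ*-elim d ∘ S⊆T)

ψ*-++ : Γ ⊢ ψ* S → Γ ⊢ ψ* T → Γ ⊢ ψ* (S ++ T)
ψ*-++ {S = S} d e = ψ*-intro ([ ψ*-elim d , ψ*-elim e ]′ ∘ ∈-++⁻ S)

Ψ*-intro : Any (λ T → Γ ⊢ ψ* T) C → Γ ⊢ Ψ* C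
Ψ*-intro = ⨆-intro ∘ Any.map⁺

Ψ*-∈ : T ∈ C → ψ* T ⇛ Ψ* C
Ψ*-∈ T∈C d = Ψ*-intro (Any.map (λ { refl → d }) T∈C)

Ψ*-elim : T ∈ C → Γ ⊢ Ψ* C → (∀ {S} → S ∈ C → ψ* S ∷ Γ ⊢ χ) → Γ ⊢ χ
Ψ*-elim {C = _ ∷ _} _ d k = ⨆-elim d (All.map⁺ (All.tabulate k))

∈-⊆⇒Any-⊆ : S ∈ C → S ⊆ T → Any (_⊆ T) C
∈-⊆⇒Any-⊆ S∈C S⊆T = Any.map (λ { refl v∈S → S⊆T v∈S }) S∈C

∈⇒Any-⊆ : T ∈ C → Any (_⊆ T) C
∈⇒Any-⊆ T∈C = ∈-⊆⇒Any-⊆ T∈C (λ v∈T → v∈T)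

Ψ*-mono : T ∈ C → (∀ {S} → S ∈ C → Any (_⊆ S) D) → Ψ* C ⇛ Ψ* D
Ψ*-mono T∈C covered d =
  Ψ*-elim T∈C d
    (Ψ*-intro ∘ Any.map {P = _⊆ _} (λ R⊆S → ψ*-antitone R⊆S (hyp (here refl))) ∘ covered)

Ψ*-⊔ : S ∈ C → T ∈ D → Ψ* C ⊔' Ψ* D ⇛ Ψ* (C ++ D)
Ψ*-⊔ {C = C} S∈C T∈D =
  ⊔-case (Ψ*-mono S∈C (∈⇒Any-⊆ ∘ ∈-++⁺ˡ)) (Ψ*-mono T∈D (∈⇒Any-⊆ ∘ ∈-++⁺ʳ C))

Ψ*-++ : T ∈ C ++ D → Ψ* (C ++ D) ⇛ Ψ* C ⊔' Ψ* D
Ψ*-++ {C = C} T∈C++D d = Ψ*-elim T∈C++D d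
  ([ (λ S∈C → ⊔I₁ (Ψ*-∈ S∈C (hyp (here refl)))) , (λ S∈D → ⊔I₂ (Ψ*-∈ S∈D (hyp (here refl)))) ]′
   ∘ ∈-++⁻ C)

_⊗_ : List (Team n) → List (Team n) → List (Team n)
_⊗_ = cartesianProductWith _++_

Ψ*-∧ : S ∈ C → T ∈ D → Ψ* C ∧' Ψ* D ⇛ Ψ* (C ⊗ D)
Ψ*-∧ S₀∈C T₀∈D d =
  Ψ*-elim S₀∈C (∧E₁ d) λ {S} S∈C →
  Ψ*-elim T₀∈D (∧E₂ (⊢-weaken (xs⊆x∷xs _ _) d)) λ {T} T∈D →
  Ψ*-∈ (∈-cartesianProductWith⁺ _++_ S∈C T∈D)
       (ψ*-++ {S = S} {T = T} (hyp (there (here refl))) (hyp (here refl)))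

Ψ*-⊗ : S ∈ C → T ∈ D → Ψ* (C ⊗ D) ⇛ Ψ* C ∧' Ψ* D
Ψ*-⊗ {C = C} {D = D} S∈C T∈D d = ∧I (Ψ*-mono S++T∈C⊗D left d) (Ψ*-mono S++T∈C⊗D right d)
  where
  S++T∈C⊗D = ∈-cartesianProductWith⁺ _++_ S∈C T∈D
  left : U ∈ C ⊗ D → Any (_⊆ U) C
  left U∈ with ∈-cartesianProductWith⁻ _++_ C D U∈
  ... | S , T , S∈C , _ , refl = ∈-⊆⇒Any-⊆ S∈C (xs⊆xs++ys S T)
  right : U ∈ C ⊗ D → Any (_⊆ U) D
  right U∈ with ∈-cartesianProductWith⁻ _++_ C D U∈
  ... | S , T , _ , T∈D , refl = ∈-⊆⇒Any-⊆ T∈D (xs⊆ys++xs T S)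

record NormalForm (φ : Form n) : Set where
  constructor normalForm
  field
    teams     : List (Team n)
    inhabited : ∃ (_∈ teams)
    φ⇛Ψ*      : φ ⇛ Ψ* teams
    Ψ*⇛φ      : Ψ* teams ⇛ φ

normalForm-⊤ : NormalForm {n} ⊤'
normalForm-⊤ = normalForm [ [] ] ([] , here refl) (λ _ → ⊤I) (λ _ → ⊤I)

normalForm-⊔ : NormalForm φ → NormalForm ψ → NormalForm (φ ⊔' ψ)
normalForm-⊔ (normalForm C (S , S∈C) φ⇛C C⇛φ) (normalForm D (T , T∈D) ψ⇛D D⇛ψ) =
  normalForm (C ++ D) (S , ∈-++⁺ˡ S∈C)
    (Ψ*-⊔ S∈C T∈D ∘ ⊔-mono φ⇛C ψ⇛D)
    (⊔-mono C⇛φ D⇛ψ ∘ Ψ*-++ {C = C} {D = D} (∈-++⁺ˡ S∈C))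

normalForm-∧ : NormalForm φ → NormalForm ψ → NormalForm (φ ∧' ψ)
normalForm-∧ (normalForm C (S , S∈C) φ⇛C C⇛φ) (normalForm D (T , T∈D) ψ⇛D D⇛ψ) =
  normalForm (C ⊗ D) (S ++ T , ∈-cartesianProductWith⁺ _++_ S∈C T∈D)
    (Ψ*-∧ S∈C T∈D ∘ ∧-mono φ⇛C ψ⇛D)
    (∧-mono C⇛φ D⇛ψ ∘ Ψ*-⊗ S∈C T∈D)

-- Atoms are handled as lists of (constant, symbol) pairs, so that the structural rules
-- become permutations, projections and extensions of one list.
atomOf : List (Const × Fin n) → Form n
atomOf L = map proj₁ L ⊆' map proj₂ L

symbols : List (Const × Fin n) → List (Fin n)
symbols = map proj₂

atomOf-++ : (K L : List (Const × Fin n)) →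
            atomOf (K ++ L) ≡ (map proj₁ K ++ map proj₁ L) ⊆' (symbols K ++ symbols L)
atomOf-++ K L = cong₂ _⊆'_ (map-++ proj₁ K L) (map-++ proj₂ K L)

atomOf-++-++ : (K L M : List (Const × Fin n)) →
               atomOf (K ++ L ++ M) ≡
               (map proj₁ K ++ map proj₁ L ++ map proj₁ M) ⊆' (symbols K ++ symbols L ++ symbols M)
atomOf-++-++ K L M = trans (atomOf-++ K (L ++ M))
  (cong₂ (λ cs is → (map proj₁ K ++ cs) ⊆' (symbols K ++ is)) (map-++ proj₁ L M) (map-++ proj₂ L M))

atomOf-rotate : Γ ⊢ atomOf (K ++ L ++ M) → Γ ⊢ atomOf (K ++ M ++ L)
atomOf-rotate {Γ = Γ} {K = K} {L = L} {M = M} d =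
  subst (Γ ⊢_) (sym (atomOf-++-++ K M L))
    (⊆Perm {x = map proj₁ K} {map proj₁ L} {map proj₁ M} {symbols K} {symbols L} {symbols M}
      (same-length L) (same-length M) (subst (Γ ⊢_) (atomOf-++-++ K L M) d))
  where
  same-length : (L : List (Const × Fin _)) → length (map proj₁ L) ≡ length (symbols L)
  same-length L = trans (length-map proj₁ L) (sym (length-map proj₂ L))

atomOf-proj : Γ ⊢ atomOf (L ++ [ a ]) → Γ ⊢ atomOf L
atomOf-proj {Γ = Γ} {L = L} {a = c , i} d =
  ⊆Proj {x = map proj₁ L} {c} {symbols L} {i} (subst (Γ ⊢_) (atomOf-++ L [ c , i ]) d)

atomOf-ext : r ∉ symbols L → Γ ⊢ atomOf L → (∀ c → atomOf ((c , r) ∷ L) ∷ Γ ⊢ χ) → Γ ⊢ χ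
atomOf-ext {r = r} {L = L} {Γ = Γ} {χ = χ} r∉L d k = ⊆Ext r∉L d (branch true) (branch false)
  where
  branch : ∀ c → (map proj₁ L ++ [ c ]) ⊆' (symbols L ++ [ r ]) ∷ Γ ⊢ χ
  branch c = ⊢-cut (atomOf-rotate {K = []} {L = L} {M = [ c , r ]}
                      (hyp (here (atomOf-++ L [ c , r ]))))
                   (⊢-weaken (∷⁺ʳ _ (xs⊆x∷xs _ _)) (k c))

atomOf-dropSuffix : Γ ⊢ atomOf (K ++ L) → Γ ⊢ atomOf K
atomOf-dropSuffix {Γ = Γ} {K = K} {L = []} d = subst (λ L → Γ ⊢ atomOf L) (++-identityʳ K) d
atomOf-dropSuffix {Γ = Γ} {K = K} {L = a ∷ L} d =
  atomOf-dropSuffix {L = L} (atomOf-proj {a = a}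
    (subst (λ L → Γ ⊢ atomOf L) (sym (++-assoc K L [ a ]))
      (atomOf-rotate {K = K} {L = [ a ]} {M = L} d)))

-- The prefix K holds the literals of M already moved into place.
atomOf-select : Unique (symbols M) → M ⊆ L → Γ ⊢ atomOf (K ++ L) → Γ ⊢ atomOf (K ++ M)
atomOf-select {M = []} {Γ = Γ} {K = K} _ _ d =
  subst (λ L → Γ ⊢ atomOf L) (sym (++-identityʳ K)) (atomOf-dropSuffix d)
atomOf-select {M = a ∷ M} {L = L} {Γ = Γ} {K = K} (a∉M ∷ uM) aM⊆L d with ∈-∃++ (aM⊆L (here refl))
... | L₁ , L₂ , refl =
  subst (λ L → Γ ⊢ atomOf L) (++-assoc K [ a ] M)
    (atomOf-select uM M⊆L₂L₁
      (subst (λ L → Γ ⊢ atomOf L) (sym (++-assoc K [ a ] (L₂ ++ L₁)))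
        (atomOf-rotate {K = K} {L = L₁} {M = a ∷ L₂} d)))
  where
  M⊆L₂L₁ : M ⊆ L₂ ++ L₁
  M⊆L₂L₁ {b} b∈M with ∈-++⁻ L₁ (aM⊆L (there b∈M))
  ... | inj₁ b∈L₁         = ∈-++⁺ʳ L₂ b∈L₁
  ... | inj₂ (here refl)  = ⊥-elim (All.lookup a∉M (∈-map⁺ proj₂ b∈M) refl)
  ... | inj₂ (there b∈L₂) = ∈-++⁺ˡ b∈L₂

atomOf-⊆ : Unique (symbols M) → M ⊆ L → atomOf L ⇛ atomOf M
atomOf-⊆ uM M⊆L = atomOf-select {K = []} uM M⊆L

Enumeration : List (Fin n) → Set
Enumeration is = Unique is × (∀ i → i ∈ is)

module _ {n : ℕ} where
  open import Data.List.Relation.Binary.Permutation.Setoid (setoid (Fin n))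
    using () renaming (↭-sym to ↭ₛ-sym)
  open import Data.List.Relation.Binary.Permutation.Setoid.Properties (setoid (Fin n))
    using (shift; Unique-resp-↭; ∈-resp-↭)

  Enumeration-shift : (R is : List (Fin n)) → Enumeration (r ∷ R ++ is) → Enumeration (R ++ r ∷ is)
  Enumeration-shift R is (u , cover) = Unique-resp-↭ σ u , λ i → ∈-resp-↭ σ (cover i)
    where σ = ↭ₛ-sym (shift refl R is)

-- Splitting with ⊆Ext on every symbol of R in turn; χ has to be derived in each branch,
-- from an atom over all symbols and under that branch's context.
atomOf-extend : (R : List (Fin n)) → Enumeration (R ++ symbols L) → Γ ⊢ atomOf L →
                (∀ {Δ M} → L ⊆ M → Enumeration (symbols M) → Δ ⊢ atomOf M → Δ ⊢ χ) → Γ ⊢ χ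
atomOf-extend [] e d k = k (λ a∈L → a∈L) e d
atomOf-extend {L = L} (r ∷ R) e@(r∉R++L ∷ _ , _) d k =
  atomOf-ext (All.All¬⇒¬Any (All.++⁻ʳ R r∉R++L)) d λ c →
    atomOf-extend R (Enumeration-shift R (symbols L) e) (hyp (here refl))
      (λ cL⊆M → k (cL⊆M ∘ there))

literals : Valuation n → List (Const × Fin n)
literals v = tabulate (λ i → lookup v i , i)

toList-tabulate-lookup : (v : Valuation n) → toList v ≡ tabulate (lookup v)
toList-tabulate-lookup []      = refl
toList-tabulate-lookup (c ∷ v) = cong (c ∷_) (toList-tabulate-lookup v)

atomOf-literals : atomOf (literals v) ≡ atom v
atomOf-literals {v = v} =
  cong₂ _⊆'_ (trans (map-tabulate _ proj₁) (sym (toList-tabulate-lookup v))) (map-tabulate _ proj₂)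

unique-symbols-literals : Unique (symbols (literals v))
unique-symbols-literals = subst Unique (sym (map-tabulate _ proj₂)) (Unique.allFin⁺ _)

-- Symbols that do not occur in the list get the arbitrary value false.
valueOf : List (Const × Fin n) → Fin n → Const
valueOf []            i = false
valueOf ((c , j) ∷ L) i with j ≟ i
... | yes _ = c
... | no  _ = valueOf L i

valueOf-∈ : (L : List (Const × Fin n)) (i : Fin n) → i ∈ symbols L → (valueOf L i , i) ∈ L
valueOf-∈ ((c , j) ∷ L) i i∈ with j ≟ i
... | yes refl = here refl
... | no  j≢i  = there (valueOf-∈ L i (Any.tail (λ i≡j → j≢i (sym i≡j)) i∈))

valueOf-unique : ∀ {c i} → Unique (symbols L) → (c , i) ∈ L → valueOf L i ≡ c
valueOf-unique {L = (_ , j) ∷ _} {i = i} (j∉L ∷ u) ci∈ with j ≟ i | ci∈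
... | yes refl | here refl  = refl
... | yes refl | there ci∈L = ⊥-elim (All.lookup j∉L (∈-map⁺ proj₂ ci∈L) refl)
... | no  j≢i  | here refl  = ⊥-elim (j≢i refl)
... | no  _    | there ci∈L = valueOf-unique u ci∈L

valuationOf : List (Const × Fin n) → Valuation n
valuationOf L = Vec.tabulate (valueOf L)

⊆-literals-valuationOf : Unique (symbols L) → L ⊆ literals (valuationOf L)
⊆-literals-valuationOf {L = L} u {c , i} ci∈L =
  subst (λ c → (c , i) ∈ literals (valuationOf L))
        (trans (lookup∘tabulate (valueOf L) i) (valueOf-unique u ci∈L))
        (∈-tabulate⁺ i)

literals-valuationOf-⊆ : (∀ i → i ∈ symbols L) → literals (valuationOf L) ⊆ L
literals-valuationOf-⊆ {L = L} cover a∈ with ∈-tabulate⁻ a∈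
... | i , refl =
  subst (λ c → (c , i) ∈ L) (sym (lookup∘tabulate (valueOf L) i)) (valueOf-∈ L i (cover i))

allValuations : (n : ℕ) → List (Valuation n)
allValuations zero    = [ [] ]
allValuations (suc n) = cartesianProductWith _∷_ (true ∷ false ∷ []) (allValuations n)

∈-allValuations : (v : Valuation n) → v ∈ allValuations n
∈-allValuations []      = here refl
∈-allValuations (c ∷ v) = ∈-cartesianProductWith⁺ _∷_ (∈-Bool c) (∈-allValuations v)
  where
  ∈-Bool : (c : Bool) → c ∈ true ∷ false ∷ []
  ∈-Bool true  = here refl
  ∈-Bool false = there (here refl)

module _ {n : ℕ} where
  open import Data.List.Membership.DecPropositional (_≟_ {n}) using (_∈?_; _∉?_)
  open import Data.List.Relation.Binary.Subset.DecPropositional (×-≡-dec Bool._≟_ (_≟_ {n}))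
    using (_⊆?_)

  Enumeration-complement : {is : List (Fin n)} → Unique is →
                           Enumeration (filter (_∉? is) (allFin n) ++ is)
  Enumeration-complement {is} u =
    Unique.++⁺ (Unique.filter⁺ (_∉? is) (Unique.allFin⁺ n)) u disjoint , cover
    where
    disjoint : ∀ {i} → ¬ (i ∈ filter (_∉? is) (allFin n) × i ∈ is)
    disjoint (i∈R , i∈is) = proj₂ (∈-filter⁻ (_∉? is) {xs = allFin n} i∈R) i∈is
    cover : ∀ i → i ∈ filter (_∉? is) (allFin n) ++ is
    cover i with i ∈? is
    ... | yes i∈is = ∈-++⁺ʳ _ i∈is
    ... | no  i∉is = ∈-++⁺ˡ (∈-filter⁺ (_∉? is) (∈-allFin i) i∉is)

  normalForm-atomOf : {L : List (Const × Fin n)} → Unique (symbols L) → NormalForm (atomOf L)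
  normalForm-atomOf {L} uL =
    normalForm 𝒞 (_ , [ valuationOf L ]∈𝒞 (⊆-literals-valuationOf uL)) atomOf⇛Ψ* Ψ*⇛atomOf
    where
    𝒞 : List (Team n)
    𝒞 = map [_] (filter (λ v → L ⊆? literals v) (allValuations n))

    [_]∈𝒞 : (v : Valuation n) → L ⊆ literals v → [ v ] ∈ 𝒞
    [ v ]∈𝒞 L⊆v = ∈-map⁺ [_] (∈-filter⁺ (λ v → L ⊆? literals v) (∈-allValuations v) L⊆v)

    atomOf⇛Ψ* : atomOf L ⇛ Ψ* 𝒞
    atomOf⇛Ψ* d = atomOf-extend (filter (_∉? symbols L) (allFin n)) (Enumeration-complement uL) d
      λ {Δ} {M} L⊆M (uM , cover) dM →
        Ψ*-∈ ([ valuationOf M ]∈𝒞 (⊆-literals-valuationOf uM ∘ L⊆M))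
             (subst (Δ ⊢_) atomOf-literals
               (atomOf-⊆ (unique-symbols-literals {v = valuationOf M})
                         (literals-valuationOf-⊆ cover) dM))

    Ψ*⇛atomOf : Ψ* 𝒞 ⇛ atomOf L
    Ψ*⇛atomOf {Γ} d = Ψ*-elim ([ valuationOf L ]∈𝒞 (⊆-literals-valuationOf uL)) d agreeing⇛atomOf
      where
      agreeing⇛atomOf : T ∈ 𝒞 → ψ* T ∷ Γ ⊢ atomOf L
      agreeing⇛atomOf T∈𝒞 with ∈-map⁻ [_] T∈𝒞
      ... | v , v∈ , refl =
        atomOf-⊆ uL (proj₂ (∈-filter⁻ (λ v → L ⊆? literals v) {xs = allValuations n} v∈))
          (hyp (here (atomOf-literals {v = v})))

map-proj₁-zip : {xs : List A} {ys : List B} → length xs ≡ length ys → map proj₁ (zip xs ys) ≡ xs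
map-proj₁-zip {xs = []}     {ys = []}    _  = refl
map-proj₁-zip {xs = x ∷ xs} {ys = _ ∷ _} eq = cong (x ∷_) (map-proj₁-zip (suc-injective eq))

map-proj₂-zip : {xs : List A} {ys : List B} → length xs ≡ length ys → map proj₂ (zip xs ys) ≡ ys
map-proj₂-zip {xs = []}    {ys = []}     _  = refl
map-proj₂-zip {xs = _ ∷ _} {ys = y ∷ ys} eq = cong (y ∷_) (map-proj₂-zip (suc-injective eq))

normalForm-⊆ : {x : List Const} {q : List (Fin n)} → Unique q → length x ≡ length q →
               NormalForm (x ⊆' q)
normalForm-⊆ uq |x|≡|q| =
  subst NormalForm (cong₂ _⊆'_ (map-proj₁-zip |x|≡|q|) (map-proj₂-zip |x|≡|q|))
    (normalForm-atomOf (subst Unique (sym (map-proj₂-zip |x|≡|q|)) uq))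

normalForm-WF : (φ : Form n) → WF φ → NormalForm φ
normalForm-WF ⊤'       _              = normalForm-⊤
normalForm-WF (x ⊆' q) (uq , |x|≡|q|) = normalForm-⊆ uq |x|≡|q|
normalForm-WF (φ ∧' ψ) (wfφ , wfψ)    = normalForm-∧ (normalForm-WF φ wfφ) (normalForm-WF ψ wfψ)
normalForm-WF (φ ⊔' ψ) (wfφ , wfψ)    = normalForm-⊔ (normalForm-WF φ wfφ) (normalForm-WF ψ wfψ)

AllPairs-deduplicate : {R : Rel A 0ℓ} (R? : Decidable R) (xs : List A) →
                       AllPairs (λ x y → ¬ R x y) (deduplicate R? xs)
AllPairs-deduplicate R? []       = []
AllPairs-deduplicate R? (x ∷ xs) =
  All.all-filter (¬? ∘ R? x) (deduplicate R? xs) ∷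
  AllPairs.filter⁺ (¬? ∘ R? x) (AllPairs-deduplicate R? xs)

module _ {n : ℕ} where
  _≟ᵥ_ : DecidableEquality (Valuation n)
  _≟ᵥ_ = Vec-≡-dec Bool._≟_

  open import Data.List.Relation.Binary.Subset.DecPropositional _≟ᵥ_ using (_⊆?_)
  open import Data.List.Relation.Unary.Unique.DecPropositional.Properties _≟ᵥ_
    using (deduplicate-!)

  SameSet : Rel (Team n) 0ℓ
  SameSet S T = S ⊆ T × T ⊆ S

  sameSet? : Decidable SameSet
  sameSet? S T = S ⊆? T ×-dec T ⊆? S

  canonical : List (Team n) → List (Team n)
  canonical C = deduplicate sameSet? (map (deduplicate _≟ᵥ_) C)

  canonical-isNonemptyTeamSet : T ∈ C → IsNonemptyTeamSet (canonical C)
  canonical-isNonemptyTeamSet {C = C@(_ ∷ _)} _ =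
    All.deduplicate⁺ sameSet? (All.map⁺ (All.universal deduplicate-! C)) ,
    AllPairs.map (λ S≉T S↭T → S≉T (⊆-reflexive-↭ S↭T , ⊆-reflexive-↭ (↭-sym S↭T)))
                 (AllPairs-deduplicate sameSet? (map (deduplicate _≟ᵥ_) C))

  Ψ*-canonical : T ∈ C → Ψ* C ⇛ Ψ* (canonical C)
  Ψ*-canonical T∈C = Ψ*-mono T∈C λ {S} S∈C →
    Any.deduplicate⁺ sameSet? (λ (y⊆x , _) x⊆S → x⊆S ∘ y⊆x)
      (∈-⊆⇒Any-⊆ (∈-map⁺ (deduplicate _≟ᵥ_) S∈C) (∈-deduplicate⁻ _≟ᵥ_ S))

  canonical-Ψ* : T ∈ C → Ψ* (canonical C) ⇛ Ψ* C
  canonical-Ψ* {C = C@(_ ∷ _)} _ = Ψ*-mono (here refl) λ U∈ →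
    covered (∈-map⁻ (deduplicate _≟ᵥ_) (∈-deduplicate⁻ sameSet? (map (deduplicate _≟ᵥ_) C) U∈))
    where
    covered : ∃ (λ S → S ∈ C × U ≡ deduplicate _≟ᵥ_ S) → Any (_⊆ U) C
    covered (S , S∈C , refl) = ∈-⊆⇒Any-⊆ S∈C (∈-deduplicate⁺ _≟ᵥ_)

mainTheorem11 : (n : ℕ) (φ : Form n) → WF φ →
    Σ (List (Team n)) λ 𝒞 → IsNonemptyTeamSet 𝒞 × ([ φ ] ⊢ Ψ* 𝒞) × ([ Ψ* 𝒞 ] ⊢ φ)
mainTheorem11 n φ wf with normalForm-WF φ wf
... | normalForm C (_ , T∈C) φ⇛Ψ* Ψ*⇛φ =
  canonical C , canonical-isNonemptyTeamSet T∈C ,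
  Ψ*-canonical T∈C (φ⇛Ψ* (hyp (here refl))) , Ψ*⇛φ (canonical-Ψ* T∈C (hyp (here refl)))
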